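{- Let $a,b,k$ be positive integers with $a,b\geq 2k$. Then $\mathrm{rc}_k(K_{a,b})\leq 4$.
   Context: Given an edge coloring $c:E(G)\to[\ell]$, a path is rainbow if no two of its edges receive the same color. $(G,c)$ is rainbow $k$-connected if every pair of distinct vertices is joined by $k$ pairwise internally disjoint rainbow paths. The rainbow $k$-connection number $\mathrm{rc}_k(G)$ is the minimum $\ell$ such that some coloring $c:E(G)\to[\ell]$ makes $(G,c)$ rainbow $k$-connected. $K_{a,b}$ denotes the complete bipartite graph with parts of sizes $a$ and $b$. -}

module Defs where

open import Data.Nat using (ℕ; _≤_)
open import Data.Fin using (Fin)
open import Data.Sum using (_⊎_; inj₁; inj₂)
open import Data.Product using (Σ; _×_; ∃-syntax)
open import Data.List using (List; []; _∷_; map)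
open import Data.List.Membership.Propositional using (_∈_)
open import Data.List.Relation.Unary.Unique.Propositional using (Unique)
open import Relation.Binary.PropositionalEquality using (_≡_; _≢_)
open import Data.Empty using (⊥)

record SimpleGraph : Set₁ where
  field
    V       : Set
    Adj     : V → V → Set
    adjSym  : ∀ {u v} → Adj u v → Adj v u
    adjIrr  : ∀ {u} → Adj u u → ⊥

module _ (G : SimpleGraph) where
  open SimpleGraph G

  record EdgeColoring (ℓ : ℕ) : Set where
    field
      col    : ∀ u v → Adj u v → Fin ℓ
      colSym : ∀ u v (e : Adj u v) → col u v e ≡ col v u (adjSym e)

  data Walk : V → V → Set where
    here : ∀ {v} → Walk v v
    step : ∀ {u w v} → Adj u w → Walk w v → Walk u v

  vertices : ∀ {u v} → Walk u v → List V
  vertices {u} here       = u ∷ []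
  vertices {u} (step e r) = u ∷ vertices r

  initVertices : ∀ {u v} → Walk u v → List V
  initVertices here           = []
  initVertices {u} (step e r) = u ∷ initVertices r

  interior : ∀ {u v} → Walk u v → List V
  interior here       = []
  interior (step e r) = initVertices r

  IsPath : ∀ {u v} → Walk u v → Set
  IsPath p = Unique (vertices p)

  module _ {ℓ : ℕ} (c : EdgeColoring ℓ) where
    open EdgeColoring c

    edgeColours : ∀ {u v} → Walk u v → List (Fin ℓ)
    edgeColours here                   = []
    edgeColours {u} (step {w = w} e r) = col u w e ∷ edgeColours r

    Rainbow : ∀ {u v} → Walk u v → Set
    Rainbow p = Unique (edgeColours p)

    InternallyDisjoint : ∀ {u v} → Walk u v → Walk u v → Set
    InternallyDisjoint p q = ∀ x → x ∈ interior p → x ∈ interior q → ⊥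

    RainbowKConnected : ℕ → Set
    RainbowKConnected k =
      ∀ u v → u ≢ v →
        Σ (Fin k → Walk u v) λ P →
          (∀ i → IsPath (P i) × Rainbow (P i)) ×
          (∀ i j → i ≢ j → (P i ≢ P j) × InternallyDisjoint (P i) (P j))

  RcAtMost : ℕ → ℕ → Set
  RcAtMost k m = ∃[ ℓ ] (ℓ ≤ m × Σ (EdgeColoring ℓ) λ c → RainbowKConnected c k)

data BipAdj (a b : ℕ) : Fin a ⊎ Fin b → Fin a ⊎ Fin b → Set where
  lr : ∀ i j → BipAdj a b (inj₁ i) (inj₂ j)
  rl : ∀ i j → BipAdj a b (inj₂ j) (inj₁ i)

bipSym : ∀ {a b u v} → BipAdj a b u v → BipAdj a b v u
bipSym (lr i j) = rl i j
bipSym (rl i j) = lr i j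

bipIrr : ∀ {a b u} → BipAdj a b u u → ⊥
bipIrr ()

K : ℕ → ℕ → SimpleGraph
K a b = record { V = Fin a ⊎ Fin b ; Adj = BipAdj a b ; adjSym = bipSym ; adjIrr = bipIrr }

-- Split each side of K_{a,b} into a low class (indices < k) and a high class (the rest), and
-- colour an edge by the pair (class of its left end, class of its right end); four colours.
-- For each t < k the t-th vertex of the low class and the t-th vertex of the high class get
-- label t, and the t-th of the k paths between two vertices uses only interior vertices
-- labelled t, which makes the paths internally disjoint. Two vertices of different classes on
-- one side are joined through a vertex of the other side, two vertices of the same class by a
-- zigzag through a vertex of the other class, and adjacent vertices by their edge together
-- with k - 1 paths of length three.
module Submission where

open import Defs
open import Data.Bool using (Bool; true; false; not; _≟_)
open import Data.Bool.Properties using (not-¬)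
open import Data.Fin using (Fin; zero; suc; toℕ; fromℕ<; combine)
open import Data.Fin.Properties using (toℕ-fromℕ<; toℕ-injective; toℕ<n; combine-injective)
open import Data.List using ([]; _∷_)
open import Data.List.Membership.Propositional using (_∈_)
open import Data.List.Relation.Unary.All as All using (All; []; _∷_)
open import Data.List.Relation.Unary.AllPairs using ([]; _∷_)
open import Data.List.Relation.Unary.Any using (here)
open import Data.Nat using (ℕ; _≤_; _<_; _*_; _+_; _∸_; _≤?_)
open import Data.Nat.Properties
  using (≤-refl; ≤-trans; m≤m+n; +-monoʳ-≤; +-monoʳ-<; <-≤-trans; <⇒≱; m+n∸m≡n)
open import Data.Product using (Σ; _×_; _,_; proj₁; proj₂)
open import Data.Sum using (_⊎_; inj₁; inj₂; [_,_])
open import Data.Sum.Properties using (inj₁-injective; inj₂-injective)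
open import Relation.Binary.PropositionalEquality
  using (_≡_; _≢_; refl; sym; trans; cong; subst; ≢-sym)
open import Relation.Nullary using (yes; no; does)
open import Relation.Nullary.Decidable using (dec-true; dec-false)

module _ (G : SimpleGraph) {ℓ : ℕ} (c : EdgeColoring G ℓ) where
  open SimpleGraph G using (V)

  RainbowPaths : ℕ → V → V → Set
  RainbowPaths k u v = Σ (Fin k → Walk G u v) λ P →
    (∀ i → IsPath G (P i) × Rainbow G c (P i)) ×
    (∀ i j → i ≢ j → (P i ≢ P j) × InternallyDisjoint G c (P i) (P j))

  rainbowPaths-byLabels : ∀ {k u v} (label : V → ℕ) (P : Fin k → Walk G u v) →
    (∀ t → IsPath G (P t) × Rainbow G c (P t)) →
    (∀ t → All (λ x → label x ≡ toℕ t) (interior G (P t))) →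
    (∀ t s → interior G (P t) ≡ [] → interior G (P s) ≡ [] → t ≡ s) →
    RainbowPaths k u v
  rainbowPaths-byLabels label P rainbowPath labelled atMostOneEdge =
    P , rainbowPath , λ t s t≢s → distinct t s t≢s , disjoint t s t≢s
    where
    disjoint : ∀ t s → t ≢ s → InternallyDisjoint G c (P t) (P s)
    disjoint t s t≢s x x∈Pt x∈Ps =
      t≢s (toℕ-injective (trans (sym (All.lookup (labelled t) x∈Pt)) (All.lookup (labelled s) x∈Ps)))

    distinct : ∀ t s → t ≢ s → P t ≢ P s
    distinct t s t≢s Pt≡Ps with interior G (P t) in int
    ... | [] = t≢s (atMostOneEdge t s int (subst (λ p → interior G p ≡ []) Pt≡Ps int))
    ... | x ∷ _ = disjoint t s t≢s x x∈Pt (subst (λ p → x ∈ interior G p) Pt≡Ps x∈Pt)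
      where
      x∈Pt : x ∈ interior G (P t)
      x∈Pt = subst (x ∈_) (sym int) (here refl)

module Halves (N k : ℕ) (2k≤N : 2 * k ≤ N) where

  isHigh : Fin N → Bool
  isHigh i = does (k ≤? toℕ i)

  label : Fin N → ℕ
  label i with isHigh i
  ... | false = toℕ i
  ... | true  = toℕ i ∸ k

  private
    k+k≤N : k + k ≤ N
    k+k≤N = ≤-trans (+-monoʳ-≤ k (m≤m+n k 0)) 2k≤N

    low< : (t : Fin k) → toℕ t < N
    low< t = <-≤-trans (toℕ<n t) (≤-trans (m≤m+n k k) k+k≤N)

    high< : (t : Fin k) → k + toℕ t < N
    high< t = <-≤-trans (+-monoʳ-< k (toℕ<n t)) k+k≤N

  pick : Bool → Fin k → Fin N
  pick false t = fromℕ< (low< t)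
  pick true  t = fromℕ< (high< t)

  isHigh-pick : ∀ β t → isHigh (pick β t) ≡ β
  isHigh-pick false t =
    dec-false (k ≤? _) λ k≤t → <⇒≱ (toℕ<n t) (subst (k ≤_) (toℕ-fromℕ< (low< t)) k≤t)
  isHigh-pick true t =
    dec-true (k ≤? _) (subst (k ≤_) (sym (toℕ-fromℕ< (high< t))) (m≤m+n k (toℕ t)))

  label-pick : ∀ β t → label (pick β t) ≡ toℕ t
  label-pick β t with isHigh (pick β t) | isHigh-pick β t
  label-pick false t | false | refl = toℕ-fromℕ< (low< t)
  label-pick true  t | true  | refl = trans (cong (_∸ k) (toℕ-fromℕ< (high< t))) (m+n∸m≡n k (toℕ t))

  isHigh-pick-≢ : ∀ {γ β} t → γ ≢ β → γ ≢ isHigh (pick β t)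
  isHigh-pick-≢ {β = β} t γ≢β γ≡ = γ≢β (trans γ≡ (isHigh-pick β t))

  isHigh-low≢high : ∀ t s → isHigh (pick false t) ≢ isHigh (pick true s)
  isHigh-low≢high t s = isHigh-pick-≢ s (subst (_≢ true) (sym (isHigh-pick false t)) λ ())

bit : Bool → Fin 2
bit false = zero
bit true  = suc zero

bit-injective : ∀ {x y} → bit x ≡ bit y → x ≡ y
bit-injective {false} {false} _ = refl
bit-injective {true}  {true}  _ = refl

-- Opaque, so that the colours along a walk stay of the form pairColour x y and the
-- classes x, y can be recovered from them by unification.
opaque
  pairColour : Bool → Bool → Fin 4
  pairColour x y = combine (bit x) (bit y)

  pairColour-injective : ∀ {x x' y y'} → pairColour x y ≡ pairColour x' y' → x ≡ x' × y ≡ y'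
  pairColour-injective {x} {x'} {y} {y'} eq
    with bx≡bx' , by≡by' ← combine-injective (bit x) (bit y) (bit x') (bit y') eq
    = bit-injective bx≡bx' , bit-injective by≡by'

pairColour-≢ˡ : ∀ {x x' y y'} → x ≢ x' → pairColour x y ≢ pairColour x' y'
pairColour-≢ˡ x≢x' eq = x≢x' (proj₁ (pairColour-injective eq))

pairColour-≢ʳ : ∀ {x x' y y'} → y ≢ y' → pairColour x y ≢ pairColour x' y'
pairColour-≢ʳ y≢y' eq = y≢y' (proj₂ (pairColour-injective eq))

module ClassColouring {a b : ℕ} (α : Fin a → Bool) (β : Fin b → Bool) where

  classColouring : EdgeColoring (K a b) 4
  classColouring = record { col = col ; colSym = colSym }
    where
    col : ∀ u v → BipAdj a b u v → Fin 4
    col _ _ (lr i j) = pairColour (α i) (β j)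
    col _ _ (rl i j) = pairColour (α i) (β j)

    colSym : ∀ u v (e : BipAdj a b u v) → col u v e ≡ col v u (bipSym e)
    colSym _ _ (lr i j) = refl
    colSym _ _ (rl i j) = refl

  RainbowPath : ∀ {u v} → Walk (K a b) u v → Set
  RainbowPath p = IsPath (K a b) p × Rainbow (K a b) classColouring p

  private
    ≢ᴬ : ∀ {i i'} → α i ≢ α i' → inj₁ {B = Fin b} i ≢ inj₁ i'
    ≢ᴬ αi≢αi' eq = αi≢αi' (cong α (inj₁-injective eq))

    ≢ᴮ : ∀ {j j'} → β j ≢ β j' → inj₂ {A = Fin a} j ≢ inj₂ j'
    ≢ᴮ βj≢βj' eq = βj≢βj' (cong β (inj₂-injective eq))

  walkᴬᴬ₂ : ∀ i j i' → Walk (K a b) (inj₁ i) (inj₁ i')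
  walkᴬᴬ₂ i j i' = step (lr i j) (step (rl i' j) here)

  walkᴬᴬ₂-rainbowPath : ∀ {i j i'} → α i ≢ α i' → RainbowPath (walkᴬᴬ₂ i j i')
  walkᴬᴬ₂-rainbowPath αi≢αi' =
    (((λ ()) ∷ ≢ᴬ αi≢αi' ∷ []) ∷ ((λ ()) ∷ []) ∷ [] ∷ [])
    , ((pairColour-≢ˡ αi≢αi' ∷ []) ∷ [] ∷ [])

  walkᴮᴮ₂ : ∀ j i j' → Walk (K a b) (inj₂ j) (inj₂ j')
  walkᴮᴮ₂ j i j' = step (rl i j) (step (lr i j') here)

  walkᴮᴮ₂-rainbowPath : ∀ {j i j'} → β j ≢ β j' → RainbowPath (walkᴮᴮ₂ j i j')
  walkᴮᴮ₂-rainbowPath βj≢βj' =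
    (((λ ()) ∷ ≢ᴮ βj≢βj' ∷ []) ∷ ((λ ()) ∷ []) ∷ [] ∷ [])
    , ((pairColour-≢ʳ βj≢βj' ∷ []) ∷ [] ∷ [])

  walkᴬᴬ₄ : ∀ i j x j' i' → Walk (K a b) (inj₁ i) (inj₁ i')
  walkᴬᴬ₄ i j x j' i' = step (lr i j) (step (rl x j) (step (lr x j') (step (rl i' j') here)))

  walkᴬᴬ₄-rainbowPath : ∀ {i j x j' i'} → inj₁ i ≢ inj₁ i' →
    α i ≢ α x → α x ≢ α i' → β j ≢ β j' → RainbowPath (walkᴬᴬ₄ i j x j' i')
  walkᴬᴬ₄-rainbowPath i≢i' αi≢αx αx≢αi' βj≢βj' =
    (((λ ()) ∷ ≢ᴬ αi≢αx ∷ (λ ()) ∷ i≢i' ∷ [])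
     ∷ ((λ ()) ∷ ≢ᴮ βj≢βj' ∷ (λ ()) ∷ [])
     ∷ ((λ ()) ∷ ≢ᴬ αx≢αi' ∷ [])
     ∷ ((λ ()) ∷ []) ∷ [] ∷ [])
    , ((pairColour-≢ˡ αi≢αx ∷ pairColour-≢ˡ αi≢αx ∷ pairColour-≢ʳ βj≢βj' ∷ [])
       ∷ (pairColour-≢ʳ βj≢βj' ∷ pairColour-≢ˡ αx≢αi' ∷ [])
       ∷ (pairColour-≢ˡ αx≢αi' ∷ [])
       ∷ [] ∷ [])

  walkᴮᴮ₄ : ∀ j i y i' j' → Walk (K a b) (inj₂ j) (inj₂ j')
  walkᴮᴮ₄ j i y i' j' = step (rl i j) (step (lr i y) (step (rl i' y) (step (lr i' j') here)))

  walkᴮᴮ₄-rainbowPath : ∀ {j i y i' j'} → inj₂ j ≢ inj₂ j' →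
    β j ≢ β y → β y ≢ β j' → α i ≢ α i' → RainbowPath (walkᴮᴮ₄ j i y i' j')
  walkᴮᴮ₄-rainbowPath j≢j' βj≢βy βy≢βj' αi≢αi' =
    (((λ ()) ∷ ≢ᴮ βj≢βy ∷ (λ ()) ∷ j≢j' ∷ [])
     ∷ ((λ ()) ∷ ≢ᴬ αi≢αi' ∷ (λ ()) ∷ [])
     ∷ ((λ ()) ∷ ≢ᴮ βy≢βj' ∷ [])
     ∷ ((λ ()) ∷ []) ∷ [] ∷ [])
    , ((pairColour-≢ʳ βj≢βy ∷ pairColour-≢ˡ αi≢αi' ∷ pairColour-≢ˡ αi≢αi' ∷ [])
       ∷ (pairColour-≢ˡ αi≢αi' ∷ pairColour-≢ˡ αi≢αi' ∷ [])
       ∷ (pairColour-≢ʳ βy≢βj' ∷ [])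
       ∷ [] ∷ [])

  walkᴬᴮ₁ : ∀ i j → Walk (K a b) (inj₁ i) (inj₂ j)
  walkᴬᴮ₁ i j = step (lr i j) here

  walkᴬᴮ₁-rainbowPath : ∀ i j → RainbowPath (walkᴬᴮ₁ i j)
  walkᴬᴮ₁-rainbowPath i j = (((λ ()) ∷ []) ∷ [] ∷ []) , ([] ∷ [])

  walkᴬᴮ₃ : ∀ i y x j → Walk (K a b) (inj₁ i) (inj₂ j)
  walkᴬᴮ₃ i y x j = step (lr i y) (step (rl x y) (step (lr x j) here))

  walkᴬᴮ₃-rainbowPath : ∀ {i y x j} → α i ≢ α x → β y ≢ β j → RainbowPath (walkᴬᴮ₃ i y x j)
  walkᴬᴮ₃-rainbowPath αi≢αx βy≢βj =
    (((λ ()) ∷ ≢ᴬ αi≢αx ∷ (λ ()) ∷ []) ∷ ((λ ()) ∷ ≢ᴮ βy≢βj ∷ []) ∷ ((λ ()) ∷ []) ∷ [] ∷ [])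
    , ((pairColour-≢ˡ αi≢αx ∷ pairColour-≢ˡ αi≢αx ∷ []) ∷ (pairColour-≢ʳ βy≢βj ∷ []) ∷ [] ∷ [])

  walkᴮᴬ₁ : ∀ j i → Walk (K a b) (inj₂ j) (inj₁ i)
  walkᴮᴬ₁ j i = step (rl i j) here

  walkᴮᴬ₁-rainbowPath : ∀ j i → RainbowPath (walkᴮᴬ₁ j i)
  walkᴮᴬ₁-rainbowPath j i = (((λ ()) ∷ []) ∷ [] ∷ []) , ([] ∷ [])

  walkᴮᴬ₃ : ∀ j x y i → Walk (K a b) (inj₂ j) (inj₁ i)
  walkᴮᴬ₃ j x y i = step (rl x j) (step (lr x y) (step (rl i y) here))

  walkᴮᴬ₃-rainbowPath : ∀ {j x y i} → β j ≢ β y → α x ≢ α i → RainbowPath (walkᴮᴬ₃ j x y i)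
  walkᴮᴬ₃-rainbowPath βj≢βy αx≢αi =
    (((λ ()) ∷ ≢ᴮ βj≢βy ∷ (λ ()) ∷ []) ∷ ((λ ()) ∷ ≢ᴬ αx≢αi ∷ []) ∷ ((λ ()) ∷ []) ∷ [] ∷ [])
    , ((pairColour-≢ʳ βj≢βy ∷ pairColour-≢ˡ αx≢αi ∷ []) ∷ (pairColour-≢ˡ αx≢αi ∷ []) ∷ [] ∷ [])

module Construction (a b k : ℕ) (2k≤a : 2 * k ≤ a) (2k≤b : 2 * k ≤ b) where
  module A = Halves a k 2k≤a
  module B = Halves b k 2k≤b
  open ClassColouring A.isHigh B.isHigh public

  label : Fin a ⊎ Fin b → ℕ
  label = [ A.label , B.label ]

  Paths : Fin a ⊎ Fin b → Fin a ⊎ Fin b → Set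
  Paths = RainbowPaths (K a b) classColouring k

  pathsᴬᴬ : ∀ i i' → inj₁ i ≢ inj₁ i' → Paths (inj₁ i) (inj₁ i')
  pathsᴬᴬ i i' i≢i' with A.isHigh i ≟ A.isHigh i'
  ... | no αi≢αi' = rainbowPaths-byLabels _ _ label
    (λ t → walkᴬᴬ₂ i (B.pick false t) i')
    (λ t → walkᴬᴬ₂-rainbowPath αi≢αi')
    (λ t → B.label-pick false t ∷ [])
    (λ _ _ ())
  ... | yes αi≡αi' = rainbowPaths-byLabels _ _ label
    (λ t → walkᴬᴬ₄ i (B.pick false t) (A.pick (not (A.isHigh i)) t) (B.pick true t) i')
    (λ t → walkᴬᴬ₄-rainbowPath i≢i' (A.isHigh-pick-≢ t (not-¬ refl))
             (≢-sym (A.isHigh-pick-≢ t (not-¬ (sym αi≡αi')))) (B.isHigh-low≢high t t))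
    (λ t → B.label-pick false t ∷ A.label-pick (not (A.isHigh i)) t ∷ B.label-pick true t ∷ [])
    (λ _ _ ())

  pathsᴮᴮ : ∀ j j' → inj₂ j ≢ inj₂ j' → Paths (inj₂ j) (inj₂ j')
  pathsᴮᴮ j j' j≢j' with B.isHigh j ≟ B.isHigh j'
  ... | no βj≢βj' = rainbowPaths-byLabels _ _ label
    (λ t → walkᴮᴮ₂ j (A.pick false t) j')
    (λ t → walkᴮᴮ₂-rainbowPath βj≢βj')
    (λ t → A.label-pick false t ∷ [])
    (λ _ _ ())
  ... | yes βj≡βj' = rainbowPaths-byLabels _ _ label
    (λ t → walkᴮᴮ₄ j (A.pick false t) (B.pick (not (B.isHigh j)) t) (A.pick true t) j')
    (λ t → walkᴮᴮ₄-rainbowPath j≢j' (B.isHigh-pick-≢ t (not-¬ refl))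
             (≢-sym (B.isHigh-pick-≢ t (not-¬ (sym βj≡βj')))) (A.isHigh-low≢high t t))
    (λ t → A.label-pick false t ∷ B.label-pick (not (B.isHigh j)) t ∷ A.label-pick true t ∷ [])
    (λ _ _ ())

  pathsᴬᴮ : ∀ i j → Paths (inj₁ i) (inj₂ j)
  pathsᴬᴮ i j = rainbowPaths-byLabels _ _ label P rainbowPath labelled atMostOneEdge
    where
    αᶜ βᶜ : Bool
    αᶜ = not (A.isHigh i)
    βᶜ = not (B.isHigh j)

    P : Fin k → Walk (K a b) (inj₁ i) (inj₂ j)
    P zero      = walkᴬᴮ₁ i j
    P t@(suc _) = walkᴬᴮ₃ i (B.pick βᶜ t) (A.pick αᶜ t) j

    rainbowPath : ∀ t → RainbowPath (P t)
    rainbowPath zero      = walkᴬᴮ₁-rainbowPath i j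
    rainbowPath t@(suc _) =
      walkᴬᴮ₃-rainbowPath (A.isHigh-pick-≢ t (not-¬ refl)) (≢-sym (B.isHigh-pick-≢ t (not-¬ refl)))

    labelled : ∀ t → All (λ v → label v ≡ toℕ t) (interior (K a b) (P t))
    labelled zero      = []
    labelled t@(suc _) = B.label-pick βᶜ t ∷ A.label-pick αᶜ t ∷ []

    atMostOneEdge : ∀ t s → interior (K a b) (P t) ≡ [] → interior (K a b) (P s) ≡ [] → t ≡ s
    atMostOneEdge zero    zero    _ _ = refl
    atMostOneEdge zero    (suc _) _ ()
    atMostOneEdge (suc _) _       ()

  pathsᴮᴬ : ∀ j i → Paths (inj₂ j) (inj₁ i)
  pathsᴮᴬ j i = rainbowPaths-byLabels _ _ label P rainbowPath labelled atMostOneEdge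
    where
    αᶜ βᶜ : Bool
    αᶜ = not (A.isHigh i)
    βᶜ = not (B.isHigh j)

    P : Fin k → Walk (K a b) (inj₂ j) (inj₁ i)
    P zero      = walkᴮᴬ₁ j i
    P t@(suc _) = walkᴮᴬ₃ j (A.pick αᶜ t) (B.pick βᶜ t) i

    rainbowPath : ∀ t → RainbowPath (P t)
    rainbowPath zero      = walkᴮᴬ₁-rainbowPath j i
    rainbowPath t@(suc _) =
      walkᴮᴬ₃-rainbowPath (B.isHigh-pick-≢ t (not-¬ refl)) (≢-sym (A.isHigh-pick-≢ t (not-¬ refl)))

    labelled : ∀ t → All (λ v → label v ≡ toℕ t) (interior (K a b) (P t))
    labelled zero      = []
    labelled t@(suc _) = A.label-pick αᶜ t ∷ B.label-pick βᶜ t ∷ []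

    atMostOneEdge : ∀ t s → interior (K a b) (P t) ≡ [] → interior (K a b) (P s) ≡ [] → t ≡ s
    atMostOneEdge zero    zero    _ _ = refl
    atMostOneEdge zero    (suc _) _ ()
    atMostOneEdge (suc _) _       ()

  rainbowKConnected : RainbowKConnected (K a b) classColouring k
  rainbowKConnected (inj₁ i) (inj₁ i') i≢i' = pathsᴬᴬ i i' i≢i'
  rainbowKConnected (inj₂ j) (inj₂ j') j≢j' = pathsᴮᴮ j j' j≢j'
  rainbowKConnected (inj₁ i) (inj₂ j) _     = pathsᴬᴮ i j
  rainbowKConnected (inj₂ j) (inj₁ i) _     = pathsᴮᴬ j i

mainTheorem2 : (a b k : ℕ) → 1 ≤ k → 2 * k ≤ a → 2 * k ≤ b → RcAtMost (K a b) k 4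
mainTheorem2 a b k _ 2k≤a 2k≤b = 4 , ≤-refl , classColouring , rainbowKConnected
  where open Construction a b k 2k≤a 2k≤b
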